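{- If $w\in S_\infty$ is totally commutative, then $a_{w,\lambda}=f^\lambda$ for every partition $\lambda$ with $|\lambda|=\ell(w)$.
   Context: $S_\infty=\bigcup_m S_m$; $s_i$ is the simple transposition swapping $i,i+1$; $\ell(w)$ is the Coxeter length and a reduced word is an expression of $w$ as a product of $\ell(w)$ simple transpositions. $w$ is totally commutative if it has a reduced word $s_{i_1}\cdots s_{i_{\ell(w)}}$ with $|i_j-i_k|\ge2$ for all $j\ne k$. $a_{w,\lambda}$ is the number of fillings of the Young diagram of $\lambda$ (English convention) by positive integers strictly increasing along rows and down columns such that, reading the entries row by row from top to bottom, each row from right to left, as $i_1,\dots,i_{|\lambda|}$, the product $s_{i_1}\cdots s_{i_{|\lambda|}}$ is a reduced word of $w$. $f^\lambda$ is the number of standard Young tableaux of shape $\lambda$. -}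

module Defs where

open import Data.Nat using (ℕ; zero; suc; _≤_; _<_; _≥_; _≟_; ∣_-_∣)
open import Data.List using (List; []; _∷_; length; map; concat; reverse; upTo)
open import Data.Nat.ListAction using (sum)
open import Data.List.Relation.Unary.All using (All)
open import Data.List.Relation.Unary.AllPairs using (AllPairs)
open import Data.List.Relation.Unary.Unique.Propositional using (Unique)
open import Data.List.Relation.Binary.Permutation.Propositional using (_↭_)
open import Data.List.Membership.Propositional using (_∈_)
open import Data.List.Relation.Unary.Linked using (Linked)
open import Data.Product using (Σ; _×_)
open import Data.Sum using (_⊎_)
open import Data.Unit using (⊤)
open import Data.Empty using (⊥)
open import Relation.Nullary using (yes; no)
open import Relation.Binary.PropositionalEquality using (_≡_)
open import Function.Definitions using (Injective)
open import Function.Bundles using (_⇔_)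

-- Permutations of the positive integers are modelled as maps ℕ → ℕ
-- (0 is an unused extra point that every element of S_∞ fixes).

s : ℕ → ℕ → ℕ
s i x with x ≟ i
... | yes _ = suc i
... | no _ with x ≟ suc i
...   | yes _ = i
...   | no _ = x

InS∞ : (ℕ → ℕ) → Set
InS∞ w = Injective _≡_ _≡_ w × Σ ℕ (λ m → ∀ x → (x ≡ 0 ⊎ m < x) → w x ≡ x)

prod : List ℕ → ℕ → ℕ
prod [] x = x
prod (i ∷ is) x = s i (prod is x)

IsWord : (ℕ → ℕ) → List ℕ → Set
IsWord w ws = All (1 ≤_) ws × (∀ x → prod ws x ≡ w x)

Reduced : (ℕ → ℕ) → List ℕ → Set
Reduced w ws = IsWord w ws × (∀ vs → IsWord w vs → length ws ≤ length vs)

HasLength : (ℕ → ℕ) → ℕ → Set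
HasLength w n = Σ (List ℕ) (λ ws → Reduced w ws × length ws ≡ n)

TotallyCommutative : (ℕ → ℕ) → Set
TotallyCommutative w = Σ (List ℕ) (λ ws → Reduced w ws × AllPairs (λ a b → 2 ≤ ∣ a - b ∣) ws)

IsPartition : List ℕ → Set
IsPartition λs = All (1 ≤_) λs × Linked _≥_ λs

-- a filling of a Young diagram is a list of rows (English convention, top row first)
-- Below r r' : row r' sits directly below row r, entries strictly increase down columns
Below : List ℕ → List ℕ → Set
Below _ [] = ⊤
Below [] (_ ∷ _) = ⊥
Below (a ∷ as) (b ∷ bs) = a < b × Below as bs

IncreasingFilling : List ℕ → List (List ℕ) → Set
IncreasingFilling λs T =
  map length T ≡ λs × All (All (1 ≤_)) T × All (Linked _<_) T × Linked Below T

readingWord : List (List ℕ) → List ℕ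
readingWord T = concat (map reverse T)

AFilling : (ℕ → ℕ) → List ℕ → List (List ℕ) → Set
AFilling w λs T = IncreasingFilling λs T × Reduced w (readingWord T)

SYT : List ℕ → List (List ℕ) → Set
SYT λs T = IncreasingFilling λs T × concat T ↭ map suc (upTo (sum λs))

IsCount : {A : Set} → (A → Set) → ℕ → Set
IsCount {A} P n = Σ (List A) (λ xs → Unique xs × (∀ x → P x ⇔ x ∈ xs) × length xs ≡ n)

{-# OPTIONS --safe #-}
module Submission where

-- A totally commutative w has a reduced word ws whose letters are pairwise at
-- distance ≥ 2, hence distinct and pairwise commuting.  For a letter i of ws,
-- w sends i to i + 1, which a product of simple transpositions avoiding s_i
-- cannot do; so every word of w contains all letters of ws, and the reduced
-- words of w are exactly the rearrangements of ws.  The fillings counted by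
-- a_{w,λ} are therefore the increasing fillings of λ whose entries are exactly
-- the letters c₁ < ⋯ < c_ℓ of ws, and standardization c_k ↦ k is an
-- order-preserving bijection from these onto the standard Young tableaux.

open import Defs
open import Data.Nat using (ℕ; zero; suc; pred; _≤_; _<_; _≮_; _≟_; _<?_; ∣_-_∣; z≤n; s≤s)
open import Data.Nat.Properties
open import Data.List using (List; []; _∷_; _++_; length; map; concat; upTo; applyUpTo; cartesianProductWith; deduplicate; filter)
open import Data.List.Properties using (length-++-sucʳ; length-map; map-∘; map-cong; map-id-local; map-upTo; concat-map; ≡-dec)
open import Data.Nat.ListAction using (sum)
open import Data.List.Relation.Unary.All as All using (All; []; _∷_; all?)
open import Data.List.Relation.Unary.All.Properties using (concat⁻) renaming (map⁺ to All-map⁺)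
open import Data.List.Relation.Unary.Any using (here; there)
open import Data.List.Relation.Unary.AllPairs as AllPairs using (AllPairs; []; _∷_)
open import Data.List.Relation.Unary.Linked using (Linked; []; [-]; _∷_; linked?)
open import Data.List.Relation.Unary.Linked.Properties using (Linked⇒AllPairs)
open import Data.List.Relation.Unary.Unique.Propositional using (Unique)
import Data.List.Relation.Unary.Unique.Propositional.Properties as Unique
import Data.List.Relation.Unary.Unique.DecPropositional.Properties as UniqueDec
open import Data.List.Relation.Unary.Unique.DecPropositional _≟_ using (unique?)
open import Data.List.Relation.Binary.Permutation.Propositional as ↭ using (_↭_; prep; swap; ↭-sym; ↭-trans; ↭⇒↭ₛ)
open import Data.List.Relation.Binary.Permutation.Propositional.Properties using (∈-resp-↭; All-resp-↭; map⁺; ↭-length; shift; ++⁺; ↭-reverse)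
import Data.List.Relation.Binary.Permutation.Setoid.Properties as ↭ₛ
open import Data.List.Membership.Propositional using (_∈_; _∉_)
open import Data.List.Membership.Propositional.Properties using (∈-map⁺; ∈-map⁻; ∈-∃++; ∈-++⁺ˡ; ∈-++⁺ʳ; ∈-++⁻; ∈-upTo⁻; ∈-cartesianProductWith⁺; ∈-filter⁺; ∈-filter⁻; ∈-deduplicate⁺; ∈-deduplicate⁻)
open import Data.List.Membership.DecPropositional _≟_ using (_∈?_)
open import Data.List.Sort ≤-decTotalOrder using (sort; sort-↭; sort-↗)
open import Data.Product using (Σ; ∃; _×_; _,_; proj₁; proj₂)
open import Data.Sum using (_⊎_; inj₁; inj₂)
open import Data.Unit using (tt)
open import Function using (id; _∘_)
open import Function.Bundles using (_⇔_; mk⇔; Equivalence)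
open import Level using (Level)
open import Relation.Binary.Core using (Rel)
open import Relation.Binary.Definitions using (DecidableEquality)
open import Relation.Binary.PropositionalEquality using (_≡_; _≢_; refl; sym; trans; cong; subst; subst₂; setoid; resp₂; module ≡-Reasoning)
open import Relation.Nullary using (Dec; yes; no; ¬_; contradiction)
open import Relation.Nullary.Decidable using (_×-dec_; _⊎-dec_; map′)
import Relation.Unary as U

open ≡-Reasoning

private
  variable
    a ℓ : Level
    A : Set a

Far : ℕ → ℕ → Set
Far i j = 2 ≤ ∣ i - j ∣

Moves : ℕ → ℕ → Set
Moves i x = x ≡ i ⊎ x ≡ suc i

moves? : ∀ i x → Dec (Moves i x)
moves? i x = x ≟ i ⊎-dec x ≟ suc i

s-at : ∀ i → s i i ≡ suc i
s-at i with i ≟ i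
... | yes _ = refl
... | no i≢i = contradiction refl i≢i

s-at-suc : ∀ i → s i (suc i) ≡ i
s-at-suc i with suc i ≟ i
... | yes 1+i≡i = contradiction 1+i≡i 1+n≢n
... | no _ with suc i ≟ suc i
...   | yes _ = refl
...   | no 1+i≢1+i = contradiction refl 1+i≢1+i

s-moves : ∀ {i x} → Moves i x → Moves i (s i x)
s-moves {i} (inj₁ refl) = inj₂ (s-at i)
s-moves {i} (inj₂ refl) = inj₁ (s-at-suc i)

s-fixes : ∀ {i x} → ¬ Moves i x → s i x ≡ x
s-fixes {i} {x} ¬moves with x ≟ i
... | yes x≡i = contradiction (inj₁ x≡i) ¬moves
... | no _ with x ≟ suc i
...   | yes x≡1+i = contradiction (inj₂ x≡1+i) ¬moves
...   | no _ = refl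

far-sym : ∀ i j → Far i j → Far j i
far-sym i j = subst (2 ≤_) (∣-∣-comm i j)

far⇒≢ : ∀ {i j} → Far i j → i ≢ j
far⇒≢ {i} far refl with subst (2 ≤_) (∣n-n∣≡0 i) far
... | ()

∣1+n-n∣≡1 : ∀ n → ∣ suc n - n ∣ ≡ 1
∣1+n-n∣≡1 zero = refl
∣1+n-n∣≡1 (suc n) = ∣1+n-n∣≡1 n

far⇒≢suc : ∀ {i j} → Far i j → i ≢ suc j
far⇒≢suc {j = j} far refl with subst (2 ≤_) (∣1+n-n∣≡1 j) far
... | s≤s ()

far⇒disjoint : ∀ {i j x} → Far i j → Moves i x → ¬ Moves j x
far⇒disjoint far (inj₁ refl) (inj₁ i≡j) = far⇒≢ far i≡j
far⇒disjoint far (inj₁ refl) (inj₂ i≡1+j) = far⇒≢suc far i≡1+j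
far⇒disjoint {i} {j} far (inj₂ refl) (inj₁ 1+i≡j) = far⇒≢suc (far-sym i j far) (sym 1+i≡j)
far⇒disjoint far (inj₂ refl) (inj₂ 1+i≡1+j) = far⇒≢ far (suc-injective 1+i≡1+j)

s-comm-moving : ∀ {i j x} → Far i j → Moves i x → s i (s j x) ≡ s j (s i x)
s-comm-moving {i} {j} {x} far moves = begin
  s i (s j x)  ≡⟨ cong (s i) (s-fixes (far⇒disjoint far moves)) ⟩
  s i x        ≡⟨ sym (s-fixes (far⇒disjoint far (s-moves moves))) ⟩
  s j (s i x)  ∎

s-comm : ∀ {i j} → Far i j → ∀ x → s i (s j x) ≡ s j (s i x)
s-comm {i} {j} far x with moves? i x | moves? j x
... | yes moves | _ = s-comm-moving far moves
... | no _ | yes moves = sym (s-comm-moving (far-sym i j far) moves)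
... | no ¬movesᵢ | no ¬movesⱼ = begin
  s i (s j x)  ≡⟨ cong (s i) (s-fixes ¬movesⱼ) ⟩
  s i x        ≡⟨ s-fixes ¬movesᵢ ⟩
  x            ≡⟨ sym (s-fixes ¬movesⱼ) ⟩
  s j x        ≡⟨ cong (s j) (sym (s-fixes ¬movesᵢ)) ⟩
  s j (s i x)  ∎

s-preserves-≤ : ∀ {i j y} → j ≢ i → y ≤ i → s j y ≤ i
s-preserves-≤ {i} {j} {y} j≢i y≤i with moves? j y
... | yes (inj₁ refl) = subst (_≤ i) (sym (s-at j)) (≤∧≢⇒< y≤i j≢i)
... | yes (inj₂ refl) = subst (_≤ i) (sym (s-at-suc j)) (<⇒≤ y≤i)
... | no ¬moves = subst (_≤ i) (sym (s-fixes ¬moves)) y≤i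

AllPairs-resp-↭ : {R : Rel A ℓ} → (∀ x y → R x y → R y x) →
  ∀ {xs ys} → xs ↭ ys → AllPairs R xs → AllPairs R ys
AllPairs-resp-↭ {R = R} R-sym p = ↭ₛ.AllPairs-resp-↭ (setoid _) (R-sym _ _) (resp₂ R) (↭⇒↭ₛ p)

Unique-resp-↭ : ∀ {xs ys : List A} → xs ↭ ys → Unique xs → Unique ys
Unique-resp-↭ p = ↭ₛ.Unique-resp-↭ (setoid _) (↭⇒↭ₛ p)

far⇒unique : ∀ {ws} → AllPairs Far ws → Unique ws
far⇒unique = AllPairs.map far⇒≢

prod-resp-↭ : ∀ {xs ys} → AllPairs Far xs → xs ↭ ys → ∀ x → prod xs x ≡ prod ys x
prod-resp-↭ _ ↭.refl x = refl
prod-resp-↭ (_ ∷ far) (prep i p) x = cong (s i) (prod-resp-↭ far p x)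
prod-resp-↭ {i ∷ j ∷ xs} ((i-j ∷ _) ∷ _ ∷ far) (swap _ _ p) x =
  trans (s-comm i-j (prod xs x)) (cong (s j ∘ s i) (prod-resp-↭ far p x))
prod-resp-↭ far (↭.trans p q) x =
  trans (prod-resp-↭ far p x) (prod-resp-↭ (AllPairs-resp-↭ far-sym p far) q x)

prod-fixes-far : ∀ {i} vs → All (Far i) vs → prod vs i ≡ i
prod-fixes-far [] [] = refl
prod-fixes-far (j ∷ vs) (far ∷ fars) =
  trans (cong (s j) (prod-fixes-far vs fars)) (s-fixes (far⇒disjoint far (inj₁ refl)))

prod-far-letter : ∀ {ws i} → AllPairs Far ws → i ∈ ws → prod ws i ≡ suc i
prod-far-letter {i = i} far i∈ws with ∈-∃++ i∈ws
... | as , bs , refl with AllPairs-resp-↭ far-sym (shift i as bs) far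
...   | i-far ∷ _ = begin
  prod (as ++ i ∷ bs) i    ≡⟨ prod-resp-↭ far (shift i as bs) i ⟩
  s i (prod (as ++ bs) i)  ≡⟨ cong (s i) (prod-fixes-far (as ++ bs) i-far) ⟩
  s i i                    ≡⟨ s-at i ⟩
  suc i                    ∎

prod-preserves-≤ : ∀ {i x} vs → i ∉ vs → x ≤ i → prod vs x ≤ i
prod-preserves-≤ [] _ x≤i = x≤i
prod-preserves-≤ (j ∷ vs) i∉ x≤i =
  s-preserves-≤ (λ j≡i → i∉ (here (sym j≡i))) (prod-preserves-≤ vs (i∉ ∘ there) x≤i)

word-contains-far-letters : ∀ {w ws vs} → IsWord w ws → AllPairs Far ws → IsWord w vs → All (_∈ vs) ws
word-contains-far-letters {ws = ws} {vs} (_ , ws≡w) far (_ , vs≡w) = All.tabulate letter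
  where
  letter : ∀ {i} → i ∈ ws → i ∈ vs
  letter {i} i∈ws with i ∈? vs
  ... | yes i∈vs = i∈vs
  ... | no i∉vs = contradiction (subst (_≤ i) vs[i]≡1+i (prod-preserves-≤ vs i∉vs ≤-refl)) 1+n≰n
    where
    vs[i]≡1+i : prod vs i ≡ suc i
    vs[i]≡1+i = trans (vs≡w i) (trans (sym (ws≡w i)) (prod-far-letter far i∈ws))

-- Reduced words of a totally commutative permutation

∈-remove : ∀ {x z : A} as bs → x ≢ z → z ∈ as ++ x ∷ bs → z ∈ as ++ bs
∈-remove as bs x≢z z∈ with ∈-++⁻ as z∈
... | inj₁ z∈as = ∈-++⁺ˡ z∈as
... | inj₂ (here z≡x) = contradiction (sym z≡x) x≢z
... | inj₂ (there z∈bs) = ∈-++⁺ʳ as z∈bs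

unique-⊆⇒↭ : ∀ {xs ys : List A} → Unique xs → All (_∈ ys) xs → length xs ≡ length ys → ys ↭ xs
unique-⊆⇒↭ {xs = []} {[]} _ _ _ = ↭.refl
unique-⊆⇒↭ {xs = x ∷ xs} (x∉xs ∷ xs!) (x∈ys ∷ xs⊆ys) |x∷xs|≡|ys| with ∈-∃++ x∈ys
... | as , bs , refl =
  ↭-trans (shift x as bs) (prep x (unique-⊆⇒↭ xs! xs⊆as++bs |xs|≡|as++bs|))
  where
  xs⊆as++bs : All (_∈ as ++ bs) xs
  xs⊆as++bs = All.zipWith (λ (x≢z , z∈) → ∈-remove as bs x≢z z∈) (x∉xs , xs⊆ys)
  |xs|≡|as++bs| : length xs ≡ length (as ++ bs)
  |xs|≡|as++bs| = suc-injective (trans |x∷xs|≡|ys| (length-++-sucʳ as x bs))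

reduced-lengths : ∀ {w ws vs} → Reduced w ws → Reduced w vs → length ws ≡ length vs
reduced-lengths (ws-word , ws-min) (vs-word , vs-min) = ≤-antisym (ws-min _ vs-word) (vs-min _ ws-word)

reduced⇒↭ : ∀ {w ws vs} → Reduced w ws → AllPairs Far ws → Reduced w vs → vs ↭ ws
reduced⇒↭ ws-red far vs-red =
  unique-⊆⇒↭ (far⇒unique far)
    (word-contains-far-letters (proj₁ ws-red) far (proj₁ vs-red))
    (reduced-lengths ws-red vs-red)

↭⇒reduced : ∀ {w ws vs} → Reduced w ws → AllPairs Far ws → vs ↭ ws → Reduced w vs
↭⇒reduced ((ws-positive , ws≡w) , ws-min) far vs↭ws =
  (All-resp-↭ (↭-sym vs↭ws) ws-positive ,
   λ x → trans (sym (prod-resp-↭ far (↭-sym vs↭ws) x)) (ws≡w x)) ,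
  λ us us-word → subst (_≤ length us) (sym (↭-length vs↭ws)) (ws-min us us-word)

IsCount-bij : ∀ {B : Set} {P : A → Set} {Q : B → Set} {n} (f : A → B) (g : B → A) →
  (∀ {x} → P x → Q (f x)) → (∀ {y} → Q y → P (g y)) →
  (∀ {x} → P x → g (f x) ≡ x) → (∀ {y} → Q y → f (g y) ≡ y) →
  IsCount P n → IsCount Q n
IsCount-bij {P = P} {Q} f g P⇒Q Q⇒P gf≡id fg≡id (xs , xs! , P⇔∈xs , |xs|≡n) =
  map f xs , unique-image (All.tabulate (Equivalence.from (P⇔∈xs _))) xs! ,
  (λ y → mk⇔ (image-∈ y) (∈-image y)) , trans (length-map f xs) |xs|≡n
  where
  f-injective : ∀ {x y} → P x → P y → f x ≡ f y → x ≡ y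
  f-injective px py fx≡fy = trans (sym (gf≡id px)) (trans (cong g fx≡fy) (gf≡id py))
  unique-image : ∀ {ys} → All P ys → Unique ys → Unique (map f ys)
  unique-image [] [] = []
  unique-image (px ∷ pys) (x∉ys ∷ ys!) =
    All-map⁺ (All.zipWith (λ (py , x≢y) fx≡fy → x≢y (f-injective px py fx≡fy)) (pys , x∉ys)) ∷
    unique-image pys ys!
  image-∈ : ∀ y → Q y → y ∈ map f xs
  image-∈ y qy = subst (_∈ map f xs) (fg≡id qy) (∈-map⁺ f (Equivalence.to (P⇔∈xs (g y)) (Q⇒P qy)))
  ∈-image : ∀ y → y ∈ map f xs → Q y
  ∈-image y y∈ with ∈-map⁻ f y∈
  ... | x , x∈xs , refl = P⇒Q (Equivalence.from (P⇔∈xs x) x∈xs)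

IsCount-resp-⇔ : ∀ {P Q : A → Set} {n} → (∀ x → P x ⇔ Q x) → IsCount P n → IsCount Q n
IsCount-resp-⇔ P⇔Q =
  IsCount-bij id id (Equivalence.to (P⇔Q _)) (Equivalence.from (P⇔Q _)) (λ _ → refl) (λ _ → refl)

decidable-⊆⇒counted : ∀ {P : A → Set} → DecidableEquality A → U.Decidable P →
  (xs : List A) → (∀ {x} → P x → x ∈ xs) → ∃ (IsCount P)
decidable-⊆⇒counted {A = A} {P = P} _≟ᴬ_ P? xs P⊆xs =
  length candidates , candidates , UniqueDec.deduplicate-! _≟ᴬ_ (filter P? xs) ,
  (λ x → mk⇔ P⇒∈ ∈⇒P) , refl
  where
  candidates : List A
  candidates = deduplicate _≟ᴬ_ (filter P? xs)
  P⇒∈ : ∀ {x} → P x → x ∈ candidates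
  P⇒∈ px = ∈-deduplicate⁺ _≟ᴬ_ (∈-filter⁺ P? (P⊆xs px) px)
  ∈⇒P : ∀ {x} → x ∈ candidates → P x
  ∈⇒P x∈ = proj₂ (∈-filter⁻ P? {xs = xs} (∈-deduplicate⁻ _≟ᴬ_ (filter P? xs) x∈))

Filling : List ℕ → List ℕ → List (List ℕ) → Set
Filling λs cs T = IncreasingFilling λs T × concat T ↭ cs

upTo₁ : ℕ → List ℕ
upTo₁ k = map suc (upTo k)

upTo₁-positive : ∀ k → All (1 ≤_) (upTo₁ k)
upTo₁-positive k = All-map⁺ (All.tabulate (λ _ → s≤s z≤n))

unique-upTo₁ : ∀ k → Unique (upTo₁ k)
unique-upTo₁ k = Unique.map⁺ suc-injective (Unique.upTo⁺ k)

entries∈ : ∀ {cs : List A} T → concat T ↭ cs → All (All (_∈ cs)) T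
entries∈ T p = concat⁻ (All.tabulate (∈-resp-↭ p))

readingWord-↭-concat : ∀ T → readingWord T ↭ concat T
readingWord-↭-concat [] = ↭.refl
readingWord-↭-concat (row ∷ T) = ++⁺ (↭-reverse row) (readingWord-↭-concat T)

Filling⇔AFilling : ∀ {w ws cs λs} → Reduced w ws → AllPairs Far ws → cs ↭ ws →
  ∀ T → Filling λs cs T ⇔ AFilling w λs T
Filling⇔AFilling ws-red far cs↭ws T = mk⇔
  (λ (inc , T↭cs) → inc ,
    ↭⇒reduced ws-red far (↭-trans (readingWord-↭-concat T) (↭-trans T↭cs cs↭ws)))
  (λ (inc , reduced) → inc ,
    ↭-trans (↭-sym (readingWord-↭-concat T)) (↭-trans (reduced⇒↭ ws-red far reduced) (↭-sym cs↭ws)))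

tuplesOver : List ℕ → ℕ → List (List ℕ)
tuplesOver cs zero = [] ∷ []
tuplesOver cs (suc k) = cartesianProductWith _∷_ cs (tuplesOver cs k)

fillingsOver : List ℕ → List ℕ → List (List (List ℕ))
fillingsOver cs [] = [] ∷ []
fillingsOver cs (k ∷ λs) = cartesianProductWith _∷_ (tuplesOver cs k) (fillingsOver cs λs)

∈-tuplesOver : ∀ {cs} row → All (_∈ cs) row → row ∈ tuplesOver cs (length row)
∈-tuplesOver [] [] = here refl
∈-tuplesOver (x ∷ row) (x∈ ∷ row⊆) = ∈-cartesianProductWith⁺ _∷_ x∈ (∈-tuplesOver row row⊆)

∈-fillingsOver : ∀ {cs} T → All (All (_∈ cs)) T → T ∈ fillingsOver cs (map length T)
∈-fillingsOver [] [] = here refl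
∈-fillingsOver (row ∷ T) (row⊆ ∷ T⊆) =
  ∈-cartesianProductWith⁺ _∷_ (∈-tuplesOver row row⊆) (∈-fillingsOver T T⊆)

below? : ∀ r r' → Dec (Below r r')
below? r [] = yes tt
below? [] (_ ∷ _) = no λ ()
below? (x ∷ r) (y ∷ r') = (x <? y) ×-dec below? r r'

increasingFilling? : ∀ λs T → Dec (IncreasingFilling λs T)
increasingFilling? λs T =
  ≡-dec _≟_ (map length T) λs ×-dec all? (all? (1 ≤?_)) T ×-dec all? (linked? _<?_) T ×-dec linked? below? T

↭-unique? : ∀ {ys} → Unique ys → ∀ xs → Dec (xs ↭ ys)
↭-unique? {ys} ys! xs = map′
  (λ (xs! , xs⊆ys , |xs|≡|ys|) → ↭-sym (unique-⊆⇒↭ xs! xs⊆ys |xs|≡|ys|))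
  (λ xs↭ys → Unique-resp-↭ (↭-sym xs↭ys) ys! , All.tabulate (∈-resp-↭ xs↭ys) , ↭-length xs↭ys)
  (unique? xs ×-dec all? (_∈? ys) xs ×-dec length xs ≟ length ys)

Filling-counted : ∀ {cs} → Unique cs → ∀ λs → ∃ (IsCount (Filling λs cs))
Filling-counted {cs} cs! λs =
  decidable-⊆⇒counted (≡-dec (≡-dec _≟_)) (λ T → increasingFilling? λs T ×-dec ↭-unique? cs! (concat T))
    (fillingsOver cs λs) λ {T} ((shape , _) , T↭cs) →
    subst (λ μ → T ∈ fillingsOver cs μ) shape (∈-fillingsOver T (entries∈ T T↭cs))

mapᵀ : (ℕ → ℕ) → List (List ℕ) → List (List ℕ)
mapᵀ f = map (map f)

mapᵀ-inverse : ∀ {f g : ℕ → ℕ} {cs} → (∀ {x} → x ∈ cs → g (f x) ≡ x) →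
  ∀ {T} → All (All (_∈ cs)) T → mapᵀ g (mapᵀ f T) ≡ T
mapᵀ-inverse {f} {g} gf≡id {T} T⊆ = trans (sym (map-∘ T)) (map-id-local (All.map row-inverse T⊆))
  where
  row-inverse : ∀ {row} → All (_∈ _) row → map g (map f row) ≡ row
  row-inverse {row} row⊆ = trans (sym (map-∘ row)) (map-id-local (All.map gf≡id row⊆))

StrictlyIncreasingOn : (ℕ → ℕ) → List ℕ → Set
StrictlyIncreasingOn f cs = ∀ {x y} → x ∈ cs → y ∈ cs → x < y → f x < f y

module Relabel (f : ℕ → ℕ) {cs ds : List ℕ} (f[cs]≡ds : map f cs ≡ ds)
               (f-increasing : StrictlyIncreasingOn f cs) (ds-positive : All (1 ≤_) ds) where

  f-∈ : ∀ {x} → x ∈ cs → f x ∈ ds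
  f-∈ x∈ = subst (_ ∈_) f[cs]≡ds (∈-map⁺ f x∈)

  increasing-row : ∀ {row} → All (_∈ cs) row → Linked _<_ row → Linked _<_ (map f row)
  increasing-row [] [] = []
  increasing-row (_ ∷ []) [-] = [-]
  increasing-row (x∈ ∷ y∈ ∷ row⊆) (x<y ∷ inc) =
    f-increasing x∈ y∈ x<y ∷ increasing-row (y∈ ∷ row⊆) inc

  below : ∀ {r r'} → All (_∈ cs) r → All (_∈ cs) r' → Below r r' → Below (map f r) (map f r')
  below {r' = []} _ _ _ = tt
  below {_ ∷ _} {_ ∷ _} (x∈ ∷ r⊆) (y∈ ∷ r'⊆) (x<y , rest) =
    f-increasing x∈ y∈ x<y , below r⊆ r'⊆ rest

  columns : ∀ {T} → All (All (_∈ cs)) T → Linked Below T → Linked Below (mapᵀ f T)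
  columns [] [] = []
  columns (_ ∷ []) [-] = [-]
  columns (r⊆ ∷ r'⊆ ∷ T⊆) (r-r' ∷ inc) = below r⊆ r'⊆ r-r' ∷ columns (r'⊆ ∷ T⊆) inc

  relabel : ∀ {λs T} → Filling λs cs T → Filling λs ds (mapᵀ f T)
  relabel {λs} {T} ((shape , _ , rows , cols) , T↭cs) =
    (trans shape-map shape , positive , rows-increasing , columns T⊆ cols) , entries-↭
    where
    T⊆ : All (All (_∈ cs)) T
    T⊆ = entries∈ T T↭cs
    rows-increasing : All (Linked _<_) (mapᵀ f T)
    rows-increasing = All-map⁺ (All.zipWith (λ (r⊆ , inc) → increasing-row r⊆ inc) (T⊆ , rows))
    entries-↭ : concat (mapᵀ f T) ↭ ds
    entries-↭ = subst (_↭ ds) (sym (concat-map T)) (subst (map f (concat T) ↭_) f[cs]≡ds (map⁺ f T↭cs))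
    shape-map : map length (mapᵀ f T) ≡ map length T
    shape-map = trans (sym (map-∘ T)) (map-cong (length-map f) T)
    positive : All (All (1 ≤_)) (mapᵀ f T)
    positive = All-map⁺ (All.map (λ r⊆ → All-map⁺ (All.map (All.lookup ds-positive ∘ f-∈) r⊆)) T⊆)

-- Standardization

sorted∧unique⇒strictlySorted : ∀ {xs} → Linked _≤_ xs → Unique xs → Linked _<_ xs
sorted∧unique⇒strictlySorted [] _ = []
sorted∧unique⇒strictlySorted [-] _ = [-]
sorted∧unique⇒strictlySorted (x≤y ∷ sorted) ((x≢y ∷ _) ∷ xs!) =
  ≤∧≢⇒< x≤y x≢y ∷ sorted∧unique⇒strictlySorted sorted xs!

-- nth returns the junk value 0 past the end of the list.
nth : List ℕ → ℕ → ℕ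
nth [] _ = 0
nth (c ∷ cs) zero = c
nth (c ∷ cs) (suc i) = nth cs i

rank : List ℕ → ℕ → ℕ
rank [] x = 0
rank (c ∷ cs) x with c <? x
... | yes _ = suc (rank cs x)
... | no _ = rank cs x

rank-< : ∀ {c x} cs → c < x → rank (c ∷ cs) x ≡ suc (rank cs x)
rank-< {c} {x} cs c<x with c <? x
... | yes _ = refl
... | no c≮x = contradiction c<x c≮x

rank-≮ : ∀ {c x} cs → c ≮ x → rank (c ∷ cs) x ≡ rank cs x
rank-≮ {c} {x} cs c≮x with c <? x
... | yes c<x = contradiction c<x c≮x
... | no _ = refl

rank-mono : ∀ cs {x y} → x ≤ y → rank cs x ≤ rank cs y
rank-mono [] _ = z≤n
rank-mono (c ∷ cs) {x} {y} x≤y with c <? x | c <? y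
... | yes _ | yes _ = s≤s (rank-mono cs x≤y)
... | yes c<x | no c≮y = contradiction (<-≤-trans c<x x≤y) c≮y
... | no _ | yes _ = m≤n⇒m≤1+n (rank-mono cs x≤y)
... | no _ | no _ = rank-mono cs x≤y

rank-head : ∀ {c} cs → All (c <_) cs → rank (c ∷ cs) c ≡ 0
rank-head {c} cs c<cs = trans (rank-≮ cs (n≮n c)) (rank-below cs c<cs)
  where
  rank-below : ∀ {x} cs → All (x <_) cs → rank cs x ≡ 0
  rank-below [] [] = refl
  rank-below (c ∷ cs) (x<c ∷ x<cs) = trans (rank-≮ cs (<⇒≯ x<c)) (rank-below cs x<cs)

nth-∈ : ∀ cs {i} → i < length cs → nth cs i ∈ cs
nth-∈ (c ∷ cs) {zero} _ = here refl
nth-∈ (c ∷ cs) {suc i} (s≤s i<) = there (nth-∈ cs i<)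

rank-nth : ∀ {cs} → AllPairs _<_ cs → ∀ {i} → i < length cs → rank cs (nth cs i) ≡ i
rank-nth {c ∷ cs} (c<cs ∷ _) {zero} _ = rank-head cs c<cs
rank-nth {c ∷ cs} (c<cs ∷ inc) {suc i} (s≤s i<) =
  trans (rank-< cs (All.lookup c<cs (nth-∈ cs i<))) (cong suc (rank-nth inc i<))

nth-rank : ∀ {cs} → AllPairs _<_ cs → ∀ {x} → x ∈ cs → nth cs (rank cs x) ≡ x
nth-rank {c ∷ cs} (c<cs ∷ _) (here refl) = cong (nth (c ∷ cs)) (rank-head cs c<cs)
nth-rank {c ∷ cs} (c<cs ∷ inc) (there x∈) =
  trans (cong (nth (c ∷ cs)) (rank-< cs (All.lookup c<cs x∈))) (nth-rank inc x∈)

applyUpTo-nth : ∀ cs → applyUpTo (nth cs) (length cs) ≡ cs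
applyUpTo-nth [] = refl
applyUpTo-nth (c ∷ cs) = cong (c ∷_) (applyUpTo-nth cs)

standardize : List ℕ → ℕ → ℕ
standardize cs x = suc (rank cs x)

destandardize : List ℕ → ℕ → ℕ
destandardize cs j = nth cs (pred j)

module _ {cs : List ℕ} (increasing : AllPairs _<_ cs) where

  standardize-destandardize : ∀ {j} → j ∈ upTo₁ (length cs) → standardize cs (destandardize cs j) ≡ j
  standardize-destandardize j∈ with ∈-map⁻ suc j∈
  ... | i , i∈ , refl = cong suc (rank-nth increasing (∈-upTo⁻ i∈))

  destandardize-standardize : ∀ {x} → x ∈ cs → destandardize cs (standardize cs x) ≡ x
  destandardize-standardize = nth-rank increasing

  standardize-increasing : StrictlyIncreasingOn (standardize cs) cs
  standardize-increasing x∈ y∈ x<y = s≤s (≤∧≢⇒< (rank-mono cs (<⇒≤ x<y)) λ rx≡ry →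
    <⇒≢ x<y (trans (sym (nth-rank increasing x∈)) (trans (cong (nth cs) rx≡ry) (nth-rank increasing y∈))))

  destandardize-increasing : StrictlyIncreasingOn (destandardize cs) (upTo₁ (length cs))
  destandardize-increasing i∈ j∈ i<j = ≰⇒> λ dj≤di →
    <⇒≱ i<j (subst₂ _≤_ (standardize-destandardize j∈) (standardize-destandardize i∈)
                        (s≤s (rank-mono cs dj≤di)))

  destandardize-upTo₁ : map (destandardize cs) (upTo₁ (length cs)) ≡ cs
  destandardize-upTo₁ = begin
    map (destandardize cs) (map suc (upTo (length cs)))  ≡⟨ sym (map-∘ (upTo (length cs))) ⟩
    map (nth cs) (upTo (length cs))                       ≡⟨ map-upTo (nth cs) (length cs) ⟩
    applyUpTo (nth cs) (length cs)                        ≡⟨ applyUpTo-nth cs ⟩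
    cs                                                    ∎

  standardize-cs : map (standardize cs) cs ≡ upTo₁ (length cs)
  standardize-cs = begin
    map (standardize cs) cs
      ≡⟨ cong (map (standardize cs)) (sym destandardize-upTo₁) ⟩
    map (standardize cs) (map (destandardize cs) (upTo₁ (length cs)))
      ≡⟨ sym (map-∘ (upTo₁ (length cs))) ⟩
    map (standardize cs ∘ destandardize cs) (upTo₁ (length cs))
      ≡⟨ map-id-local (All.tabulate standardize-destandardize) ⟩
    upTo₁ (length cs)
      ∎

  destandardize-count : ∀ {λs n} → All (1 ≤_) cs →
    IsCount (Filling λs (upTo₁ (length cs))) n → IsCount (Filling λs cs) n
  destandardize-count positive =
    IsCount-bij (mapᵀ (destandardize cs)) (mapᵀ (standardize cs)) Destandardize.relabel Standardize.relabel
      (λ {T} (_ , T↭) → mapᵀ-inverse standardize-destandardize (entries∈ T T↭))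
      (λ {T} (_ , T↭) → mapᵀ-inverse destandardize-standardize (entries∈ T T↭))
    where
    module Destandardize = Relabel (destandardize cs) destandardize-upTo₁ destandardize-increasing positive
    module Standardize = Relabel (standardize cs) standardize-cs standardize-increasing (upTo₁-positive (length cs))

lemma3p2 : (w : ℕ → ℕ) → InS∞ w → TotallyCommutative w →
    (λs : List ℕ) → IsPartition λs → HasLength w (sum λs) →
    Σ ℕ (λ n → IsCount (AFilling w λs) n × IsCount (SYT λs) n)
lemma3p2 w _ (ws , ws-reduced , far) λs _ (vs , vs-reduced , |vs|≡|λ|) =
  n , IsCount-resp-⇔ (Filling⇔AFilling ws-reduced far cs↭ws) cs-fillings , syt
  where
  cs : List ℕ
  cs = sort ws
  cs↭ws : cs ↭ ws
  cs↭ws = sort-↭ ws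
  cs-increasing : AllPairs _<_ cs
  cs-increasing = Linked⇒AllPairs <-trans
    (sorted∧unique⇒strictlySorted (sort-↗ ws) (Unique-resp-↭ (↭-sym cs↭ws) (far⇒unique far)))
  |cs|≡|λ| : length cs ≡ sum λs
  |cs|≡|λ| = trans (↭-length cs↭ws) (trans (reduced-lengths ws-reduced vs-reduced) |vs|≡|λ|)
  -- SYT λs unfolds to Filling λs (upTo₁ (sum λs)).
  counted : ∃ (IsCount (SYT λs))
  counted = Filling-counted (unique-upTo₁ (sum λs)) λs
  n : ℕ
  n = proj₁ counted
  syt : IsCount (SYT λs) n
  syt = proj₂ counted
  cs-fillings : IsCount (Filling λs cs) n
  cs-fillings = destandardize-count cs-increasing (All-resp-↭ (↭-sym cs↭ws) (proj₁ (proj₁ ws-reduced)))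
    (subst (λ k → IsCount (Filling λs (upTo₁ k)) n) (sym |cs|≡|λ|) syt)
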